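{- For every finite connected graph $G$, $\delta(G)=\delta(\mathcal{H}(G))$, where $\mathcal{H}(G)$ denotes the injective hull of $G$. In particular, the class of $\delta$-hyperbolic graphs is closed under Hellification: if $G$ is $\delta$-hyperbolic then so is $\mathcal{H}(G)$.
   Context: All graphs are finite, undirected, connected, without loops or multiple edges, with the shortest-path metric $d_G$. A disk is $D_G(v,r)=\{u: d_G(u,v)\le r\}$. A graph is Helly if every family of pairwise intersecting disks has nonempty common intersection. The injective hull $\mathcal{H}(G)$ of $G$ is the unique minimal Helly graph containing $G$ as an isometric subgraph; concretely its vertices are the functions $f:V(G)\to\mathbb{Z}_{\ge 0}$ with $f(x)+f(y)\ge d_G(x,y)$ for all $x,y$ and such that for every $x$ there is $y$ with $f(x)+f(y)=d_G(x,y)$, two such functions being adjacent iff $\max_x|f(x)-g(x)|=1$; $G$ embeds via $z\mapsto d_G(z,\cdot)$. A graph is $\delta$-hyperbolic if for any four vertices $u,v,w,x$ the two largest of the sums $d(u,v)+d(w,x)$, $d(u,x)+d(v,w)$, $d(u,w)+d(v,x)$ differ by at most $2\delta$; $\delta(G)$ is the least such $\delta$. A class $\mathcal{C}$ is closed under Hellification if $G\in\mathcal{C}$ implies $\mathcal{H}(G)\in\mathcal{C}$. -}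

module Defs where

open import Data.Nat using (ℕ; zero; suc; _+_; _≤_; _⊔_; _⊓_; ∣_-_∣)
open import Data.Fin using (Fin)
open import Data.Product using (Σ; ∃; ∃-syntax; _×_; _,_; proj₁)
open import Relation.Binary.PropositionalEquality using (_≡_)
open import Relation.Nullary using (¬_)
open import Function.Bundles using (_⇔_)

record Graph : Set₁ where
  field
    V   : Set
    _≈_ : V → V → Set
    Adj : V → V → Set

module _ (H : Graph) where
  open Graph H

  data Walk : V → V → ℕ → Set where
    stop : ∀ {u v} → u ≈ v → Walk u v zero
    step : ∀ {u w v k} → Adj u w → Walk w v k → Walk u v (suc k)

  Dist : V → V → ℕ → Set
  Dist u v k = Walk u v k × (∀ j → Walk u v j → k ≤ j)

  -- Four-point condition with 2δ = k (δ = k/2; all relevant δ are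
  -- half-integers).  For the three sums, the largest minus the second
  -- largest (the median) is at most 2δ.
  largest : ℕ → ℕ → ℕ → ℕ
  largest p q r = p ⊔ q ⊔ r

  median : ℕ → ℕ → ℕ → ℕ
  median p q r = (p ⊓ q) ⊔ (q ⊓ r) ⊔ (p ⊓ r)

  Hyperbolic2 : ℕ → Set
  Hyperbolic2 k =
    ∀ u v w x (duv dwx dux dvw duw dvx : ℕ) →
    Dist u v duv → Dist w x dwx → Dist u x dux →
    Dist v w dvw → Dist u w duw → Dist v x dvx →
    largest (duv + dwx) (dux + dvw) (duw + dvx)
      ≤ median (duv + dwx) (dux + dvw) (duw + dvx) + k

  IsTwiceHyperbolicity : ℕ → Set
  IsTwiceHyperbolicity k = Hyperbolic2 k × (∀ j → Hyperbolic2 j → k ≤ j)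

record FinGraph : Set₁ where
  field
    n        : ℕ
    Adj      : Fin n → Fin n → Set
    symm     : ∀ {u v} → Adj u v → Adj v u
    irrefl   : ∀ {u} → ¬ Adj u u

  asGraph : Graph
  asGraph = record { V = Fin n ; _≈_ = _≡_ ; Adj = Adj }

record FinConnGraph : Set₁ where
  field
    graph     : FinGraph
  open FinGraph graph public
  field
    connected : ∀ u v → ∃[ k ] Walk asGraph u v k

module _ (G : FinConnGraph) where
  open FinConnGraph G

  dG : Fin n → Fin n → ℕ → Set
  dG = Dist asGraph

  IsHullVertex : (Fin n → ℕ) → Set
  IsHullVertex f =
    (∀ x y k → dG x y k → k ≤ f x + f y) ×
    (∀ x → ∃[ y ] ∃[ k ] (dG x y k × f x + f y ≡ k))

  HullV : Set
  HullV = Σ (Fin n → ℕ) IsHullVertex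

  HullAdj : HullV → HullV → Set
  HullAdj (f , _) (g , _) =
    (∀ x → ∣ f x - g x ∣ ≤ 1) × (∃[ x ] ∣ f x - g x ∣ ≡ 1)

  HullEq : HullV → HullV → Set
  HullEq (f , _) (g , _) = ∀ x → f x ≡ g x

  Hull : Graph
  Hull = record { V = HullV ; _≈_ = HullEq ; Adj = HullAdj }

module Submission where

-- Write d for the metric of G.  A function c : V(G) → ℕ is admissible if
-- c x + c y ≥ d(x,y); hull vertices are the admissible functions that are
-- tight at every point.  Conversely z ↦ d(z,·) embeds G
--      isometrically into H(G), which gives the other direction.
--  (4) Adjacency of G is not decidable, so the distance function of G exists
--      only under a double negation; the conclusions are inequalities of
--      naturals, hence stable, so this costs nothing.

open import Defs
open import Level using (0ℓ)
open import Data.Nat using (ℕ; zero; suc; pred; _+_; _≤_; _<_; _⊔_; _⊓_; ∣_-_∣; z≤n; s≤s; _≤?_)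
  renaming (_≟_ to _≟ℕ_)
open import Data.Nat.Properties hiding (_≟_)
open import Data.Nat.Induction using (<-rec)
open import Data.Nat.Tactic.RingSolver using (solve-∀)
open import Data.Fin using (Fin; zero; suc; _≟_)
open import Data.Fin.Properties using (all?; any?; ¬∀⟶∃¬)
open import Data.Empty using (⊥-elim)
open import Data.Sum using (_⊎_; inj₁; inj₂)
open import Data.Product using (Σ; ∃-syntax; _×_; _,_; proj₁; proj₂)
open import Function.Bundles using (_⇔_; mk⇔)
open import Relation.Nullary using (¬_; Dec; yes; no)
open import Relation.Nullary.Negation using (¬¬-Monad)
open import Relation.Nullary.Decidable using (¬¬-excluded-middle; decidable-stable)
open import Relation.Binary.PropositionalEquality using (_≡_; refl; sym; trans; cong; cong₂; subst)
open import Effect.Monad using (RawMonad)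

open RawMonad (¬¬-Monad {a = 0ℓ}) using (pure; _>>=_)
open ≤-Reasoning hiding (stop)

-- Arithmetic of ℕ

∣-∣≤⇒≤+ : ∀ a b {m} → ∣ a - b ∣ ≤ m → a ≤ b + m
∣-∣≤⇒≤+ a b p = ≤-trans (m≤n+∣m-n∣ a b) (+-monoʳ-≤ b p)

∣-∣≤⇒≥ : ∀ a b {m} → ∣ a - b ∣ ≤ m → b ≤ a + m
∣-∣≤⇒≥ a b p = ≤-trans (m≤n+∣n-m∣ b a) (+-monoʳ-≤ a p)

≤+⇒∣-∣≤ : ∀ a b {m} → a ≤ b + m → b ≤ a + m → ∣ a - b ∣ ≤ m
≤+⇒∣-∣≤ zero    b       p q = q
≤+⇒∣-∣≤ (suc a) zero    p q = p
≤+⇒∣-∣≤ (suc a) (suc b) (s≤s p) (s≤s q) = ≤+⇒∣-∣≤ a b p q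

≤∣-∣⇒gap : ∀ a b {s} → s ≤ ∣ a - b ∣ → b + s ≤ a ⊎ a + s ≤ b
≤∣-∣⇒gap zero    b       p = inj₂ p
≤∣-∣⇒gap (suc a) zero    p = inj₁ p
≤∣-∣⇒gap (suc a) (suc b) p with ≤∣-∣⇒gap a b p
... | inj₁ q = inj₁ (s≤s q)
... | inj₂ q = inj₂ (s≤s q)

∣-∣≤1⇒≡1 : ∀ a b → ∣ a - b ∣ ≤ 1 → ¬ a ≡ b → ∣ a - b ∣ ≡ 1
∣-∣≤1⇒≡1 a b le a≢b = ≤-antisym le (n≢0⇒n>0 (λ e → a≢b (∣m-n∣≡0⇒m≡n e)))

<⇒≤pred+ : ∀ m n {k} → k < m + n → k ≤ pred m + n
<⇒≤pred+ zero    n lt = <⇒≤ lt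
<⇒≤pred+ (suc m) n lt = ≤-pred lt

pred-< : ∀ {m} → 0 < m → pred m < m
pred-< {suc m} _ = ≤-refl

≤⊓+⊓ : ∀ {k} X Y Z V → k ≤ X + Z → k ≤ X + V → k ≤ Y + Z → k ≤ Y + V → k ≤ X ⊓ Y + Z ⊓ V
≤⊓+⊓ {k} X Y Z V xz xv yz yv = begin
  k                                           ≤⟨ ⊓-glb (⊓-glb xz xv) (⊓-glb yz yv) ⟩
  ((X + Z) ⊓ (X + V)) ⊓ ((Y + Z) ⊓ (Y + V))   ≡⟨ sym (cong₂ _⊓_ (+-distribˡ-⊓ X Z V) (+-distribˡ-⊓ Y Z V)) ⟩
  (X + Z ⊓ V) ⊓ (Y + Z ⊓ V)                   ≡⟨ sym (+-distribʳ-⊓ (Z ⊓ V) X Y) ⟩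
  X ⊓ Y + Z ⊓ V                               ∎

total : ∀ {m} → (Fin m → ℕ) → ℕ
total {zero}  f = 0
total {suc m} f = f zero + total (λ i → f (suc i))

total-mono : ∀ {m} {f g : Fin m → ℕ} → (∀ i → f i ≤ g i) → total f ≤ total g
total-mono {zero}  f≤g = z≤n
total-mono {suc m} f≤g = +-mono-≤ (f≤g zero) (total-mono (λ i → f≤g (suc i)))

total-< : ∀ {m} {f g : Fin m → ℕ} → (∀ i → f i ≤ g i) → ∀ j → f j < g j → total f < total g
total-< f≤g zero    lt = +-mono-<-≤ lt (total-mono (λ i → f≤g (suc i)))
total-< f≤g (suc j) lt = +-mono-≤-< (f≤g zero) (total-< (λ i → f≤g (suc i)) j lt)

≤⊔+⇒≤⊓⊔⊓+ : ∀ X Y Z k → X ≤ Y ⊔ Z + k → X ≤ (X ⊓ Y) ⊔ (X ⊓ Z) + k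
≤⊔+⇒≤⊓⊔⊓+ X Y Z k h = begin
  X                       ≤⟨ ⊓-glb (m≤m+n X k) h ⟩
  (X + k) ⊓ (Y ⊔ Z + k)   ≡⟨ sym (+-distribʳ-⊓ k X (Y ⊔ Z)) ⟩
  X ⊓ (Y ⊔ Z) + k         ≡⟨ cong (_+ k) (⊓-distribˡ-⊔ X Y Z) ⟩
  (X ⊓ Y) ⊔ (X ⊓ Z) + k   ∎

pairwise⇒four-point : ∀ A B C k → A ≤ B ⊔ C + k → B ≤ A ⊔ C + k → C ≤ A ⊔ B + k →
                      A ⊔ B ⊔ C ≤ (A ⊓ B) ⊔ (B ⊓ C) ⊔ (A ⊓ C) + k
pairwise⇒four-point A B C k a b c = ⊔-lub (⊔-lub
    (bound A B C ab ac a)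
    (bound B A C (subst (_≤ M) (⊓-comm A B) ab) bc b))
    (bound C A B (subst (_≤ M) (⊓-comm A C) ac) (subst (_≤ M) (⊓-comm B C) bc) c)
  where
  M : ℕ
  M = (A ⊓ B) ⊔ (B ⊓ C) ⊔ (A ⊓ C)
  ab : A ⊓ B ≤ M
  ab = ≤-trans (m≤m⊔n (A ⊓ B) (B ⊓ C)) (m≤m⊔n _ (A ⊓ C))
  bc : B ⊓ C ≤ M
  bc = ≤-trans (m≤n⊔m (A ⊓ B) (B ⊓ C)) (m≤m⊔n _ (A ⊓ C))
  ac : A ⊓ C ≤ M
  ac = m≤n⊔m _ (A ⊓ C)
  bound : ∀ X Y Z → X ⊓ Y ≤ M → X ⊓ Z ≤ M → X ≤ Y ⊔ Z + k → X ≤ M + k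
  bound X Y Z xy xz h = ≤-trans (≤⊔+⇒≤⊓⊔⊓+ X Y Z k h) (+-monoˡ-≤ k (⊔-lub xy xz))

four-point⇒pairwise : ∀ A B C k → A ⊔ B ⊔ C ≤ (A ⊓ B) ⊔ (B ⊓ C) ⊔ (A ⊓ C) + k →
                      A ≤ B ⊔ C + k
four-point⇒pairwise A B C k h = begin
  A                                  ≤⟨ ≤-trans (m≤m⊔n A B) (m≤m⊔n (A ⊔ B) C) ⟩
  A ⊔ B ⊔ C                          ≤⟨ h ⟩
  (A ⊓ B) ⊔ (B ⊓ C) ⊔ (A ⊓ C) + k    ≤⟨ +-monoˡ-≤ k median≤B⊔C ⟩
  B ⊔ C + k                          ∎
  where
  median≤B⊔C : (A ⊓ B) ⊔ (B ⊓ C) ⊔ (A ⊓ C) ≤ B ⊔ C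
  median≤B⊔C = ⊔-lub (⊔-lub (≤-trans (m⊓n≤n A B) (m≤m⊔n B C)) (≤-trans (m⊓n≤m B C) (m≤m⊔n B C)))
                     (≤-trans (m⊓n≤n A C) (m≤n⊔m B C))

-- Double negation

¬¬-∀-Fin : ∀ m (P : Fin m → Set) → (∀ i → ¬ ¬ P i) → ¬ ¬ (∀ i → P i)
¬¬-∀-Fin zero    P h = pure (λ ())
¬¬-∀-Fin (suc m) P h =
  h zero >>= λ p₀ → ¬¬-∀-Fin m (λ i → P (suc i)) (λ i → h (suc i)) >>= λ ps →
  pure (λ { zero → p₀ ; (suc i) → ps i })

¬¬-least : (P : ℕ → Set) → ∀ K → P K → ¬ ¬ (∃[ k ] (P k × (∀ j → P j → k ≤ j)))
¬¬-least P = <-rec (λ K → P K → ¬ ¬ Least) descend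
  where
  Least : Set
  Least = ∃[ k ] (P k × (∀ j → P j → k ≤ j))
  descend : ∀ K → (∀ {j} → j < K → P j → ¬ ¬ Least) → P K → ¬ ¬ Least
  descend K rec pK = ¬¬-excluded-middle {A = ∃[ j ] (j < K × P j)} >>= λ where
    (yes (j , j<K , pj)) → rec j<K pj
    (no none)            → pure (K , pK , λ j pj → ≮⇒≥ (λ j<K → none (j , j<K , pj)))

-- The four-point condition is a family of decidable inequalities.
Hyperbolic2-stable : ∀ (H : Graph) k → ¬ ¬ Hyperbolic2 H k → Hyperbolic2 H k
Hyperbolic2-stable H k hyp u v w x a b c e f g p₁ p₂ p₃ p₄ p₅ p₆ =
  decidable-stable (_ ≤? _) (λ fails → hyp (λ h → fails (h u v w x a b c e f g p₁ p₂ p₃ p₄ p₅ p₆)))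

twice-hyperbolicity-transfer : ∀ {H H′ : Graph} →
  (∀ k → Hyperbolic2 H k → Hyperbolic2 H′ k) → (∀ k → Hyperbolic2 H′ k → Hyperbolic2 H k) →
  ∀ k → IsTwiceHyperbolicity H k → IsTwiceHyperbolicity H′ k
twice-hyperbolicity-transfer to from k (hyp , least) = to k hyp , λ j hj → least j (from j hj)

-- The path metric of a finite simple graph

module Metric (G : FinGraph) where
  open FinGraph G

  W : Fin n → Fin n → ℕ → Set
  W = Walk asGraph

  D : Fin n → Fin n → ℕ → Set
  D = Dist asGraph

  _++ᵂ_ : ∀ {u v w j k} → W u v j → W v w k → W u w (j + k)
  stop refl ++ᵂ q = q
  step a p  ++ᵂ q = step a (p ++ᵂ q)

  reverse : ∀ {u v k} → W u v k → W v u k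
  reverse (stop refl) = stop refl
  reverse {k = suc k} (step a p) = subst (W _ _) (+-comm k 1) (reverse p ++ᵂ step (symm a) (stop refl))

  Dist-sym : ∀ {u v k} → D u v k → D v u k
  Dist-sym (w , least) = reverse w , λ j p → least j (reverse p)

  Dist-unique : ∀ {u v a b} → D u v a → D u v b → a ≡ b
  Dist-unique (w , least) (w′ , least′) = ≤-antisym (least _ w′) (least′ _ w)

  Dist-refl : ∀ {u} → D u u 0
  Dist-refl = stop refl , λ _ _ → z≤n

  Dist-triangle : ∀ {u v w a b c} → D u v a → D v w b → D u w c → c ≤ a + b
  Dist-triangle (p , _) (q , _) (_ , least) = least _ (p ++ᵂ q)

  Dist-adj : ∀ {u v} → Adj u v → D u v 1
  Dist-adj a = step a (stop refl) , λ where
    zero    (stop refl) → ⊥-elim (irrefl a)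
    (suc j) _           → s≤s z≤n

DistanceFunction : FinConnGraph → Set
DistanceFunction G = ∀ x y → ∃[ k ] dG G x y k

¬¬-distance-function : ∀ G → ¬ ¬ DistanceFunction G
¬¬-distance-function G =
  ¬¬-∀-Fin n _ λ x → ¬¬-∀-Fin n _ λ y →
    let (K , w) = connected x y in ¬¬-least (Walk asGraph x y) K w
  where open FinConnGraph G

-- Geometry of the injective hull, given the distance function of G

module HullGeometry (G : FinConnGraph) (O : DistanceFunction G) where
  open FinConnGraph G
  open Metric graph

  d : Fin n → Fin n → ℕ
  d x y = proj₁ (O x y)

  d-dist : ∀ x y → D x y (d x y)
  d-dist x y = proj₂ (O x y)

  d-refl : ∀ x → d x x ≡ 0
  d-refl x = Dist-unique (d-dist x x) Dist-refl

  fn : HullV G → Fin n → ℕ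
  fn = proj₁

  HW : HullV G → HullV G → ℕ → Set
  HW = Walk (Hull G)

  HD : HullV G → HullV G → ℕ → Set
  HD = Dist (Hull G)

  Admissible : (Fin n → ℕ) → Set
  Admissible c = ∀ x y k → D x y k → k ≤ c x + c y

  Tight : (Fin n → ℕ) → Fin n → Set
  Tight c x = ∃[ y ] (c x + c y ≡ d x y)

  tight? : ∀ c x → Dec (Tight c x)
  tight? c x = any? (λ y → c x + c y ≟ℕ d x y)

  Within : (Fin n → ℕ) → (Fin n → ℕ) → ℕ → Set
  Within f g m = ∀ x → ∣ f x - g x ∣ ≤ m

  lower : (Fin n → ℕ) → Fin n → Fin n → ℕ
  lower c x y with y ≟ x
  ... | yes _ = pred (c x)
  ... | no  _ = c y

  lower-≤ : ∀ c x y → lower c x y ≤ c y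
  lower-≤ c x y with y ≟ x
  ... | yes refl = pred[n]≤n
  ... | no  _    = ≤-refl

  lower-< : ∀ c x → 0 < c x → lower c x x < c x
  lower-< c x pos with x ≟ x
  ... | yes _   = pred-< pos
  ... | no  x≢x = ⊥-elim (x≢x refl)

  -- At a non-tight point an admissible c is strict against every point,
  -- and in particular positive (c x = 0 would be tight against x).
  non-tight-strict : ∀ c {x} → Admissible c → ¬ Tight c x → ∀ y k → D x y k → k < c x + c y
  non-tight-strict c {x} adm loose y k dk =
    ≤∧≢⇒< (adm x y k dk) (λ e → loose (y , trans (sym e) (Dist-unique dk (d-dist x y))))

  non-tight-positive : ∀ {c x} → ¬ Tight c x → 0 < c x
  non-tight-positive {c} {x} loose =
    n≢0⇒n>0 (λ e → loose (x , trans (cong (λ t → t + t) e) (sym (d-refl x))))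

  lower-admissible : ∀ c {x} → Admissible c → ¬ Tight c x → Admissible (lower c x)
  lower-admissible c {x} adm loose a b k dk with a ≟ x | b ≟ x
  ... | yes refl | yes refl = ≤-trans (≤-reflexive (Dist-unique dk Dist-refl)) z≤n
  ... | yes refl | no  _    = <⇒≤pred+ (c a) (c b) (non-tight-strict c adm loose b k dk)
  ... | no  _    | yes refl = subst (k ≤_) (+-comm (pred (c b)) (c a))
                                (<⇒≤pred+ (c b) (c a) (non-tight-strict c adm loose a k (Dist-sym dk)))
  ... | no  _    | no  _    = adm a b k dk

  -- (1) Every admissible function dominates a hull vertex: lower it at
  -- non-tight points; the total decreases, so this terminates.
  hull-vertex-below : ∀ c → Admissible c → Σ (Fin n → ℕ) λ h → IsHullVertex G h × (∀ x → h x ≤ c x)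
  hull-vertex-below c = <-rec Below descend (total c) c refl
    where
    Below : ℕ → Set
    Below s = ∀ c → total c ≡ s → Admissible c → Σ (Fin n → ℕ) λ h → IsHullVertex G h × (∀ x → h x ≤ c x)
    descend : ∀ s → (∀ {s′} → s′ < s → Below s′) → Below s
    descend _ rec c refl adm with all? (tight? c)
    ... | yes tight = c , (adm , λ x → let (y , e) = tight x in y , d x y , d-dist x y , e) , λ _ → ≤-refl
    ... | no  ¬tight with ¬∀⟶∃¬ n (Tight c) (tight? c) ¬tight
    ...   | (x , loose) =
      let decrease = total-< (lower-≤ c x) x (lower-< c x (non-tight-positive {c} loose))
          (h , hv , h≤) = rec decrease (lower c x) refl (lower-admissible c adm loose)
      in h , hv , λ y → ≤-trans (h≤ y) (lower-≤ c x y)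

  -- If a hull vertex f bounds an admissible h by h ≤ f + t, then also
  -- f ≤ h + t: compare both at a tight pair of f.
  tight-bounded-below : ∀ (f : HullV G) h → Admissible h → ∀ t → (∀ y → h y ≤ fn f y + t) →
                        ∀ y → fn f y ≤ h y + t
  tight-bounded-below (f , _ , tight) h adm t h≤f y with tight y
  ... | (z , k , dk , e) = +-cancelʳ-≤ (f z) (f y) (h y + t) (begin
    f y + f z          ≡⟨ e ⟩
    k                  ≤⟨ adm y z k dk ⟩
    h y + h z          ≤⟨ +-monoʳ-≤ (h y) (h≤f z) ⟩
    h y + (f z + t)    ≡⟨ regroup (h y) (f z) t ⟩
    h y + t + f z      ∎)
    where
    regroup : ∀ a b c → a + (b + c) ≡ a + c + b
    regroup = solve-∀

  meet-admissible : ∀ f g s t → Admissible f → Admissible g → Within f g (s + t) →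
                    Admissible (λ x → (f x + s) ⊓ (g x + t))
  meet-admissible f g s t adm-f adm-g close a b k dk = ≤⊓+⊓ (f a + s) (g a + t) (f b + s) (g b + t)
    (≤-trans (adm-f a b k dk) (+-mono-≤ (m≤m+n (f a) s) (m≤m+n (f b) s)))
    (≤-trans (adm-f a b k dk) (≤-trans (+-monoʳ-≤ (f a) (∣-∣≤⇒≤+ (f b) (g b) (close b)))
                                        (≤-reflexive (interchange (f a) (g b) s t))))
    (≤-trans (adm-g a b k dk) (≤-trans (+-monoʳ-≤ (g a) (∣-∣≤⇒≥ (f b) (g b) (close b)))
                                        (≤-reflexive (interchange′ (g a) (f b) s t))))
    (≤-trans (adm-g a b k dk) (+-mono-≤ (m≤m+n (g a) t) (m≤m+n (g b) t)))
    where
    interchange : ∀ p q s t → p + (q + (s + t)) ≡ p + s + (q + t)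
    interchange = solve-∀
    interchange′ : ∀ p q s t → p + (q + (s + t)) ≡ p + t + (q + s)
    interchange′ = solve-∀

  hull-step : ∀ {m} (f g : HullV G) → Within (fn f) (fn g) (suc m) →
              Σ (HullV G) λ r → Within (fn f) (fn r) 1 × Within (fn r) (fn g) m
  hull-step {m} p@(f , adm-f , _) q@(g , adm-g , _) close =
    (h , hv) ,
    (λ y → ≤+⇒∣-∣≤ (f y) (h y) (tight-bounded-below p h adm-h 1 h≤f+1 y) (h≤f+1 y)) ,
    (λ y → ≤+⇒∣-∣≤ (h y) (g y) (h≤g+m y) (tight-bounded-below q h adm-h m h≤g+m y))
    where
    below : Σ (Fin n → ℕ) λ h → IsHullVertex G h × (∀ x → h x ≤ (f x + 1) ⊓ (g x + m))
    below = hull-vertex-below (λ x → (f x + 1) ⊓ (g x + m)) (meet-admissible f g 1 m adm-f adm-g close)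
    h : Fin n → ℕ
    h = proj₁ below
    hv : IsHullVertex G h
    hv = proj₁ (proj₂ below)
    adm-h : Admissible h
    adm-h = proj₁ hv
    h≤f+1 : ∀ y → h y ≤ f y + 1
    h≤f+1 y = ≤-trans (proj₂ (proj₂ below) y) (m⊓n≤m _ _)
    h≤g+m : ∀ y → h y ≤ g y + m
    h≤g+m y = ≤-trans (proj₂ (proj₂ below) y) (m⊓n≤n _ _)

  step-moves : ∀ {m} (f r g : Fin n → ℕ) x → ∣ f x - r x ∣ ≤ 1 → ∣ r x - g x ∣ ≤ m →
               ¬ ∣ f x - g x ∣ ≤ m → ∣ f x - r x ∣ ≡ 1
  step-moves {m} f r g x f≈r r≈g far =
    ∣-∣≤1⇒≡1 (f x) (r x) f≈r (λ e → far (subst (λ z → ∣ z - g x ∣ ≤ m) (sym e) r≈g))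

  hull-walk : ∀ m (f g : HullV G) → Within (fn f) (fn g) m → ∃[ j ] (j ≤ m × HW f g j)
  hull-walk zero f g close = 0 , z≤n , stop (λ x → ∣m-n∣≡0⇒m≡n (n≤0⇒n≡0 (close x)))
  hull-walk (suc m) f g close with all? (λ x → ∣ fn f x - fn g x ∣ ≤? m)
  ... | yes closer = let (j , j≤m , w) = hull-walk m f g closer in j , m≤n⇒m≤1+n j≤m , w
  ... | no ¬closer =
    let (x , far)       = ¬∀⟶∃¬ n _ (λ x → ∣ fn f x - fn g x ∣ ≤? m) ¬closer
        (r , f≈r , r≈g) = hull-step f g close
        (j , j≤m , w)   = hull-walk m r g r≈g
    in suc j , s≤s j≤m , step (f≈r , x , step-moves (fn f) (fn r) (fn g) x (f≈r x) (r≈g x) far) w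

  walk⇒within : ∀ {f g j} → HW f g j → Within (fn f) (fn g) j
  walk⇒within (stop e) x = ≤-reflexive (m≡n⇒∣m-n∣≡0 (e x))
  walk⇒within {f} {g} (step {w = r} a w) x =
    ≤-trans (∣-∣-triangle (fn f x) (fn r x) (fn g x)) (+-mono-≤ (proj₁ a x) (walk⇒within w x))

  hull-dist-within : ∀ {f g δ} → HD f g δ → Within (fn f) (fn g) δ
  hull-dist-within (w , _) = walk⇒within w

  hull-dist-least : ∀ {f g δ} → HD f g δ → ∀ m → Within (fn f) (fn g) m → δ ≤ m
  hull-dist-least {f} {g} (_ , least) m close = let (j , j≤m , w) = hull-walk m f g close in ≤-trans (least j w) j≤m

  within-sym : ∀ f g {m} → Within f g m → Within g f m
  within-sym f g {m} close x = subst (_≤ m) (∣-∣-comm (f x) (g x)) (close x)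

  hull-dist-sym : ∀ {f g δ} → HD f g δ → HD g f δ
  hull-dist-sym {f} {g} {δ} hd =
    let (j , j≤δ , w) = hull-walk δ g f (within-sym (fn f) (fn g) (hull-dist-within hd))
        j≡δ = ≤-antisym j≤δ (hull-dist-least hd j (within-sym (fn g) (fn f) (walk⇒within w)))
    in subst (HW g f) j≡δ w , λ j′ w′ → hull-dist-least hd j′ (within-sym (fn g) (fn f) (walk⇒within w′))

  dist-≤-through-hull : ∀ {f g δ} → HD f g δ → ∀ a b k → D a b k → k ≤ fn f a + δ + fn g b
  dist-≤-through-hull {f} {g} {δ} hd a b k dk = begin
    k                        ≤⟨ proj₁ (proj₂ f) a b k dk ⟩
    fn f a + fn f b          ≤⟨ +-monoʳ-≤ (fn f a) (∣-∣≤⇒≤+ (fn f b) (fn g b) (hull-dist-within hd b)) ⟩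
    fn f a + (fn g b + δ)    ≡⟨ regroup (fn f a) (fn g b) δ ⟩
    fn f a + δ + fn g b      ∎
    where
    regroup : ∀ a b c → a + (b + c) ≡ a + c + b
    regroup = solve-∀

  far-coordinate : ∀ {f g δ} → HD f g δ → Fin n → ∃[ x ] (δ ≤ ∣ fn f x - fn g x ∣)
  far-coordinate {δ = zero} _ x₀ = x₀ , z≤n
  far-coordinate {f} {g} {suc m} hd _ with all? (λ x → ∣ fn f x - fn g x ∣ ≤? m)
  ... | yes closer = ⊥-elim (1+n≰n (hull-dist-least hd m closer))
  ... | no ¬closer = let (x , far) = ¬∀⟶∃¬ n _ (λ x → ∣ fn f x - fn g x ∣ ≤? m) ¬closer in x , ≰⇒> far

  gap-pair : ∀ (g : HullV G) (e : Fin n → ℕ) x s → e x + s ≤ fn g x →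
             ∃[ y ] ∃[ k ] (D x y k × e x + s + fn g y ≤ k)
  gap-pair (g , _ , tight) e x s gap with tight x
  ... | (y , k , dk , eq) = y , k , dk , ≤-trans (+-monoˡ-≤ (g y) gap) (≤-reflexive eq)

  hull-dist-realised : ∀ {f g δ} → HD f g δ → Fin n →
                       ∃[ a ] ∃[ b ] ∃[ k ] (D a b k × δ + fn f a + fn g b ≤ k)
  hull-dist-realised {f} {g} {δ} hd x₀ with far-coordinate hd x₀
  ... | (x , far) with ≤∣-∣⇒gap (fn f x) (fn g x) far
  ...   | inj₁ gap = let (y , k , dk , bound) = gap-pair f (fn g) x δ gap in
    y , x , k , Dist-sym dk , ≤-trans (≤-reflexive (regroup δ (fn f y) (fn g x))) bound
    where
    regroup : ∀ a b c → a + b + c ≡ c + a + b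
    regroup = solve-∀
  ...   | inj₂ gap = let (y , k , dk , bound) = gap-pair g (fn f) x δ gap in
    x , y , k , dk , subst (_≤ k) (cong (_+ fn g y) (+-comm (fn f x) δ)) bound

-- Transfer of the four-point condition between G and H(G)

inhabited? : ∀ m → Fin m ⊎ ¬ Fin m
inhabited? zero    = inj₂ (λ ())
inhabited? (suc m) = inj₁ zero

module Transfer (G : FinConnGraph) (O : DistanceFunction G) where
  open FinConnGraph G
  open Metric graph
  open HullGeometry G O

  pairing-bound : ∀ k → Hyperbolic2 asGraph k → ∀ (p₁ p₂ p₃ p₄ : HullV G) {D₁₂ D₃₄ D₁₃ D₂₄ D₁₄ D₂₃} →
                  HD p₁ p₂ D₁₂ → HD p₃ p₄ D₃₄ → HD p₁ p₃ D₁₃ → HD p₂ p₄ D₂₄ → HD p₁ p₄ D₁₄ → HD p₂ p₃ D₂₃ →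
                  D₁₂ + D₃₄ ≤ (D₁₄ + D₂₃) ⊔ (D₁₃ + D₂₄) + k
  pairing-bound k hyp p₁ p₂ p₃ p₄ {D₁₂} {D₃₄} {D₁₃} {D₂₄} {D₁₄} {D₂₃} h₁₂ h₃₄ h₁₃ h₂₄ h₁₄ h₂₃
    with inhabited? n
  -- Without points of G all hull distances vanish.
  ... | inj₂ empty = ≤-trans (+-mono-≤ (hull-dist-least h₁₂ 0 (λ x → ⊥-elim (empty x)))
                                      (hull-dist-least h₃₄ 0 (λ x → ⊥-elim (empty x)))) z≤n
  ... | inj₁ x₀ with hull-dist-realised h₁₂ x₀ | hull-dist-realised h₃₄ x₀
  ...   | (a₁ , a₂ , k₁₂ , d₁₂ , r₁₂) | (a₃ , a₄ , k₃₄ , d₃₄ , r₃₄) = +-cancelʳ-≤ P _ _ (begin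
    D₁₂ + D₃₄ + P                                  ≡⟨ split D₁₂ D₃₄ P₁ P₂ P₃ P₄ ⟩
    (D₁₂ + P₁ + P₂) + (D₃₄ + P₃ + P₄)              ≤⟨ +-mono-≤ r₁₂ r₃₄ ⟩
    k₁₂ + k₃₄                                      ≤⟨ four-point⇒pairwise _ _ _ k (hyp a₁ a₂ a₃ a₄ _ _ _ _ _ _
                                                        d₁₂ d₃₄ (d-dist a₁ a₄) (d-dist a₂ a₃) (d-dist a₁ a₃) (d-dist a₂ a₄)) ⟩
    (d a₁ a₄ + d a₂ a₃) ⊔ (d a₁ a₃ + d a₂ a₄) + k   ≤⟨ +-monoˡ-≤ k (⊔-mono-≤ via₁₄₂₃ via₁₃₂₄) ⟩
    (D₁₄ + D₂₃ + P) ⊔ (D₁₃ + D₂₄ + P) + k          ≡⟨ cong (_+ k) (sym (+-distribʳ-⊔ P (D₁₄ + D₂₃) (D₁₃ + D₂₄))) ⟩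
    (D₁₄ + D₂₃) ⊔ (D₁₃ + D₂₄) + P + k              ≡⟨ swap ((D₁₄ + D₂₃) ⊔ (D₁₃ + D₂₄)) P k ⟩
    (D₁₄ + D₂₃) ⊔ (D₁₃ + D₂₄) + k + P              ∎)
    where
    P₁ P₂ P₃ P₄ P : ℕ
    P₁ = fn p₁ a₁ ; P₂ = fn p₂ a₂ ; P₃ = fn p₃ a₃ ; P₄ = fn p₄ a₄
    P = P₁ + P₂ + P₃ + P₄
    swap : ∀ X p q → X + p + q ≡ X + q + p
    swap = solve-∀
    split : ∀ A B p q r s → A + B + (p + q + r + s) ≡ (A + p + q) + (B + r + s)
    split = solve-∀
    collect₁₄₂₃ : ∀ A B p q r s → (p + A + s) + (q + B + r) ≡ A + B + (p + q + r + s)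
    collect₁₄₂₃ = solve-∀
    collect₁₃₂₄ : ∀ A B p q r s → (p + A + r) + (q + B + s) ≡ A + B + (p + q + r + s)
    collect₁₃₂₄ = solve-∀
    via₁₄₂₃ : d a₁ a₄ + d a₂ a₃ ≤ D₁₄ + D₂₃ + P
    via₁₄₂₃ = ≤-trans (+-mono-≤ (dist-≤-through-hull h₁₄ a₁ a₄ _ (d-dist a₁ a₄))
                                (dist-≤-through-hull h₂₃ a₂ a₃ _ (d-dist a₂ a₃)))
                      (≤-reflexive (collect₁₄₂₃ D₁₄ D₂₃ P₁ P₂ P₃ P₄))
    via₁₃₂₄ : d a₁ a₃ + d a₂ a₄ ≤ D₁₃ + D₂₄ + P
    via₁₃₂₄ = ≤-trans (+-mono-≤ (dist-≤-through-hull h₁₃ a₁ a₃ _ (d-dist a₁ a₃))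
                                (dist-≤-through-hull h₂₄ a₂ a₄ _ (d-dist a₂ a₄)))
                      (≤-reflexive (collect₁₃₂₄ D₁₃ D₂₄ P₁ P₂ P₃ P₄))

  hull-hyperbolic : ∀ k → Hyperbolic2 asGraph k → Hyperbolic2 (Hull G) k
  hull-hyperbolic k hyp u v w x Duv Dwx Dux Dvw Duw Dvx huv hwx hux hvw huw hvx =
    pairwise⇒four-point (Duv + Dwx) (Dux + Dvw) (Duw + Dvx) k
      (pairing-bound k hyp u v w x huv hwx huw hvx hux hvw)
      (≤-trans (pairing-bound k hyp u x v w hux hvw huv (hull-dist-sym hwx) huw (hull-dist-sym hvx))
               (≤-reflexive (cong (_+ k) (⊔-comm (Duw + Dvx) (Duv + Dwx)))))
      (≤-trans (pairing-bound k hyp u w v x huw hvx huv hwx hux (hull-dist-sym hvw))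
               (≤-reflexive (cong (_+ k) (⊔-comm (Dux + Dvw) (Duv + Dwx)))))

  d-sym : ∀ x y → d x y ≡ d y x
  d-sym x y = Dist-unique (d-dist x y) (Dist-sym (d-dist y x))

  embed : Fin n → HullV G
  embed z = d z ,
            (λ x y k dk → Dist-triangle (Dist-sym (d-dist z x)) (d-dist z y) dk) ,
            (λ x → z , d x z , d-dist x z , (begin-equality
               d z x + d z z   ≡⟨ cong (d z x +_) (d-refl z) ⟩
               d z x + 0       ≡⟨ +-identityʳ (d z x) ⟩
               d z x           ≡⟨ d-sym z x ⟩
               d x z           ∎))

  embed-adj : ∀ {u v} → Adj u v → HullAdj G (embed u) (embed v)
  embed-adj {u} {v} a =
    (λ x → ≤+⇒∣-∣≤ (d u x) (d v x)
       (subst (d u x ≤_) (+-comm 1 (d v x)) (Dist-triangle (Dist-adj a) (d-dist v x) (d-dist u x)))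
       (subst (d v x ≤_) (+-comm 1 (d u x)) (Dist-triangle (Dist-adj (symm a)) (d-dist u x) (d-dist v x)))) ,
    u , cong₂ ∣_-_∣ (d-refl u) (Dist-unique (d-dist v u) (Dist-adj (symm a)))

  embed-walk : ∀ {u v j} → W u v j → HW (embed u) (embed v) j
  embed-walk (stop refl) = stop (λ _ → refl)
  embed-walk (step a w)  = step (embed-adj a) (embed-walk w)

  -- The embedding is isometric: a hull walk from embed u to embed v moves
  -- coordinate u from 0 to d(v,u).
  embed-dist : ∀ {u v k} → D u v k → HD (embed u) (embed v) k
  embed-dist {u} {v} {k} (w , least) = embed-walk w , λ j w′ → begin
    k                            ≡⟨ Dist-unique (Dist-sym (w , least)) (d-dist v u) ⟩
    d v u                        ≡⟨ cong (λ z → ∣ z - d v u ∣) (sym (d-refl u)) ⟩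
    ∣ d u u - d v u ∣            ≤⟨ walk⇒within w′ u ⟩
    j                            ∎

  -- G is an isometric subgraph of H(G), so it inherits the four-point condition.
  graph-hyperbolic : ∀ k → Hyperbolic2 (Hull G) k → Hyperbolic2 asGraph k
  graph-hyperbolic k hyp u v w x Duv Dwx Dux Dvw Duw Dvx huv hwx hux hvw huw hvx =
    hyp (embed u) (embed v) (embed w) (embed x) Duv Dwx Dux Dvw Duw Dvx
        (embed-dist huv) (embed-dist hwx) (embed-dist hux) (embed-dist hvw) (embed-dist huw) (embed-dist hvx)

theorem2 : (G : FinConnGraph) →
    (∀ k → IsTwiceHyperbolicity (FinGraph.asGraph (FinConnGraph.graph G)) k
    ⇔ IsTwiceHyperbolicity (Hull G) k)
    × (∀ k → Hyperbolic2 (FinGraph.asGraph (FinConnGraph.graph G)) k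
    → Hyperbolic2 (Hull G) k)
theorem2 G = (λ k → mk⇔ (twice-hyperbolicity-transfer up down k) (twice-hyperbolicity-transfer down up k)) , up
  where
  open FinConnGraph G using (asGraph)
  up : ∀ k → Hyperbolic2 asGraph k → Hyperbolic2 (Hull G) k
  up k hyp = Hyperbolic2-stable (Hull G) k
    (¬¬-distance-function G >>= λ O → pure (Transfer.hull-hyperbolic G O k hyp))
  down : ∀ k → Hyperbolic2 (Hull G) k → Hyperbolic2 asGraph k
  down k hyp = Hyperbolic2-stable asGraph k
    (¬¬-distance-function G >>= λ O → pure (Transfer.graph-hyperbolic G O k hyp))
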